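{- Let $n,\delta$ be positive integers. Any data structure that supports ${\textsf{rankA}}_1$ queries, or ${\textsf{dselectA}}_1$ queries, with additive error $\delta$ on an arbitrary bit-string of length $n$ requires at least $\lfloor n/(2\delta)\rfloor\lg\delta$ bits.
   Context: For a bit-string $B[1\dots n]$ and $b\in\{0,1\}$: ${\textsf{rank}}_b(i,B)$ is the number of $b$'s in $B[1\dots i]$, and ${\textsf{select}}_b(i,B)$ is the position of the $i$-th $b$ in $B$. ${\textsf{rankA}}_b(i,B,\delta)$ returns any value $r$ with ${\textsf{rank}}_b(i-\delta,B)<r\le{\textsf{rank}}_b(i,B)$, and if ${\textsf{rank}}_b(i-\delta,B)={\textsf{rank}}_b(i,B)$ it returns ${\textsf{rank}}_b(i,B)$. ${\textsf{dselectA}}_b(i,B,\delta)$ returns any position $p$ with ${\textsf{select}}_b(i,B)-\delta<p\le{\textsf{select}}_b(i,B)$. -}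

module Defs where

open import Data.Bool using (Bool; true; false; if_then_else_)
open import Data.Bool.Properties using () renaming (_≟_ to _≟ᵇ_)
open import Data.Nat using (ℕ; zero; suc; _+_; _*_; _∸_; _≤_; _<_; _^_; _/_)
open import Data.List using (List; []; _∷_)
open import Data.Vec using (Vec; toList)
open import Data.Product using (_×_; Σ)
open import Data.Sum using (_⊎_)
open import Relation.Binary.PropositionalEquality using (_≡_)
open import Relation.Nullary using (yes; no)

-- Bit-strings B[1..n] are vectors 'Vec Bool n' (true = 1, false = 0).

rankL : Bool → ℕ → List Bool → ℕ
rankL b zero    _        = 0
rankL b (suc i) []       = 0
rankL b (suc i) (x ∷ xs) with x ≟ᵇ b
... | yes _ = suc (rankL b i xs)
... | no  _ = rankL b i xs

rank : ∀ {n} → Bool → ℕ → Vec Bool n → ℕ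
rank b i B = rankL b i (toList B)

-- select b i over a list: 1-based position of the i-th b (meaningful for 1 ≤ i ≤ #b's)
selectL : Bool → ℕ → List Bool → ℕ
selectL b zero    _        = 0
selectL b (suc i) []       = 0
selectL b (suc i) (x ∷ xs) with x ≟ᵇ b
selectL b (suc zero)    (x ∷ xs) | yes _ = 1
selectL b (suc (suc i)) (x ∷ xs) | yes _ = suc (selectL b (suc i) xs)
selectL b (suc i)       (x ∷ xs) | no  _ = suc (selectL b (suc i) xs)

select : ∀ {n} → Bool → ℕ → Vec Bool n → ℕ
select b i B = selectL b i (toList B)

-- r is a valid answer to rankA_b(i, B, δ)
-- (i - δ truncated at 0; rank of a non-positive prefix is 0)
IsRankA : ∀ {n} → Bool → ℕ → Vec Bool n → ℕ → ℕ → Set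
IsRankA b i B δ r =
  (rank b (i ∸ δ) B < r × r ≤ rank b i B)
  ⊎ (rank b (i ∸ δ) B ≡ rank b i B × r ≡ rank b i B)

IsDSelectA : ∀ {n} → Bool → ℕ → Vec Bool n → ℕ → ℕ → Set
IsDSelectA b i B δ p = select b i B < p + δ × p ≤ select b i B

-- A data structure using s bits on bit-strings of length n:
-- an arbitrary encoding into s bits plus an arbitrary query function that
-- may read the whole encoding (information-theoretic model).
record DataStructure (n s : ℕ) : Set where
  field
    encode : Vec Bool n → Vec Bool s
    query  : Vec Bool s → ℕ → ℕ

SupportsRankA : ∀ {n s} → ℕ → DataStructure n s → Set
SupportsRankA {n} δ D = ∀ (B : Vec Bool n) (i : ℕ) → 1 ≤ i → i ≤ n →
  IsRankA true i B δ (DataStructure.query D (DataStructure.encode D B) i)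

SupportsDSelectA : ∀ {n s} → ℕ → DataStructure n s → Set
SupportsDSelectA {n} δ D = ∀ (B : Vec Bool n) (i : ℕ) → 1 ≤ i → i ≤ rank true n B →
  IsDSelectA true i B δ (DataStructure.query D (DataStructure.encode D B) i)

-- Let k = ⌊n/2δ⌋ and, for c = (c₀,…,c_{k-1}) with every cⱼ < δ, let B_c consist of k blocks of
-- length 2δ, block j being 1^cⱼ 0^δ 1^(δ-cⱼ), padded with zeros. If cⱼ < c'ⱼ, a single query has no
-- answer that is valid on both B_c and B_c': at position 2δj + cⱼ + δ the last δ bits of B_c are
-- zeros, so rankA must return exactly δj + cⱼ, whereas on B_c' the rank rises above δj + cⱼ inside
-- that window; and the (δj + cⱼ + 1)-th one lies exactly δ positions later in B_c than in B_c'.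
-- Hence the encoding is injective on these δ^k strings, which gives δ^k ≤ 2^s.
module Submission where

open import Defs
open import Data.Bool using (Bool; true; false; if_then_else_; _∨_)
open import Data.Bool.Properties using (∨-zeroʳ)
open import Data.Empty using (⊥; ⊥-elim)
open import Data.Fin using (Fin; zero; suc; toℕ; funToFin; finToFun; combine)
open import Data.Fin.Properties
  using (toℕ-injective; toℕ<n; injective⇒≤; 2↔Bool; finToFun-funToFin; funToFin-finToFin)
open import Data.Nat
open import Data.Nat.DivMod using (m/n*n≤m)
open import Data.Nat.Properties
open import Data.Product using (Σ; _×_; _,_; proj₁; proj₂)
open import Data.Sum using (inj₁; inj₂)
open import Data.Vec using (Vec; tabulate; lookup)
open import Data.Vec.Properties using (tabulate∘lookup; tabulate-cong)
open import Function using (_∘_; Inverse)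
open import Relation.Binary.Definitions using (tri<; tri≈; tri>)
open import Relation.Binary.PropositionalEquality
open import Relation.Nullary.Decidable using (does; dec-true; dec-false)

count : ℕ → (ℕ → Bool) → ℕ
count zero    g = 0
count (suc m) g = if g 0 then suc (count m (g ∘ suc)) else count m (g ∘ suc)

count-+ : ∀ m t g → count (m + t) g ≡ count m g + count t (λ q → g (m + q))
count-+ zero    t g = refl
count-+ (suc m) t g with g 0
... | true  = cong suc (count-+ m t (g ∘ suc))
... | false = count-+ m t (g ∘ suc)

count-cong : ∀ m {g h} → (∀ q → q < m → g q ≡ h q) → count m g ≡ count m h
count-cong zero    g≡h = refl
count-cong (suc m) {h = h} g≡h rewrite g≡h 0 z<s = cong (λ c → if h 0 then suc c else c)
  (count-cong m (λ q q<m → g≡h (suc q) (s<s q<m)))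

count-allTrue : ∀ m {g} → (∀ q → q < m → g q ≡ true) → count m g ≡ m
count-allTrue zero    _ = refl
count-allTrue (suc m) g≡true rewrite g≡true 0 z<s =
  cong suc (count-allTrue m (λ q q<m → g≡true (suc q) (s<s q<m)))

count-allFalse : ∀ m {g} → (∀ q → q < m → g q ≡ false) → count m g ≡ 0
count-allFalse zero    _ = refl
count-allFalse (suc m) g≡false rewrite g≡false 0 z<s =
  count-allFalse m (λ q q<m → g≡false (suc q) (s<s q<m))

count-mono : ∀ {m m'} g → m ≤ m' → count m g ≤ count m' g
count-mono g z≤n = z≤n
count-mono g (s≤s m≤m') with g 0
... | true  = s≤s (count-mono (g ∘ suc) m≤m')
... | false = count-mono (g ∘ suc) m≤m'

tabulateℕ : (n : ℕ) → (ℕ → Bool) → Vec Bool n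
tabulateℕ n g = tabulate (g ∘ toℕ)

rank-tabulateℕ : ∀ {i n} g → i ≤ n → rank true i (tabulateℕ n g) ≡ count i g
rank-tabulateℕ g z≤n = refl
rank-tabulateℕ g (s≤s i≤n) with g 0
... | true  = cong suc (rank-tabulateℕ (g ∘ suc) i≤n)
... | false = rank-tabulateℕ (g ∘ suc) i≤n

select-tabulateℕ : ∀ {a n} g → a < n → g a ≡ true →
  select true (suc (count a g)) (tabulateℕ n g) ≡ suc a
select-tabulateℕ {zero}  g (s≤s _) g0≡true rewrite g0≡true = refl
select-tabulateℕ {suc a} g (s≤s a<n) ga≡true with g 0
... | true  = cong suc (select-tabulateℕ (g ∘ suc) a<n ga≡true)
... | false = cong suc (select-tabulateℕ (g ∘ suc) a<n ga≡true)

module Blocks (w : ℕ) (block : ℕ → ℕ → Bool) where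

  blocks : (k : ℕ) → (Fin k → ℕ) → ℕ → Bool
  blocks zero    c x = false
  blocks (suc k) c x =
    if does (x <? w) then block (c zero) x else blocks k (c ∘ suc) (x ∸ w)

  blocks-head : ∀ {k} c {x} → x < w → blocks (suc k) c x ≡ block (c zero) x
  blocks-head c {x} x<w rewrite dec-true (x <? w) x<w = refl

  blocks-tail : ∀ {k} c x → blocks (suc k) c (w + x) ≡ blocks k (c ∘ suc) x
  blocks-tail c x rewrite dec-false (w + x <? w) (m+n≮m w x) | m+n∸m≡n w x = refl

  blocks-at : ∀ {k} c (j : Fin k) {q} → q < w → blocks k c (toℕ j * w + q) ≡ block (c j) q
  blocks-at c zero    q<w = blocks-head c q<w
  blocks-at c (suc j) {q} q<w = begin
    blocks _ c (w + toℕ j * w + q)   ≡⟨ cong (blocks _ c) (+-assoc w (toℕ j * w) q) ⟩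
    blocks _ c (w + (toℕ j * w + q)) ≡⟨ blocks-tail c _ ⟩
    blocks _ (c ∘ suc) (toℕ j * w + q) ≡⟨ blocks-at (c ∘ suc) j q<w ⟩
    block (c (suc j)) q                ∎
    where open ≡-Reasoning

  count-blocks : ∀ {k} c {m} → (∀ j → count w (block (c j)) ≡ m) →
    (j : Fin k) {t : ℕ} → t ≤ w →
    count (toℕ j * w + t) (blocks k c) ≡ toℕ j * m + count t (block (c j))
  count-blocks c weight zero t≤w =
    count-cong _ (λ q q<t → blocks-head c (<-≤-trans q<t t≤w))
  count-blocks c {m} weight (suc j) {t} t≤w = begin
    count (w + toℕ j * w + t) (blocks _ c)
      ≡⟨ cong (λ x → count x (blocks _ c)) (+-assoc w (toℕ j * w) t) ⟩
    count (w + (toℕ j * w + t)) (blocks _ c)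
      ≡⟨ count-+ w _ _ ⟩
    count w (blocks _ c) + count (toℕ j * w + t) (λ q → blocks _ c (w + q))
      ≡⟨ cong₂ _+_ (count-blocks c weight zero ≤-refl)
                   (count-cong (toℕ j * w + t) (λ q _ → blocks-tail c q)) ⟩
    count w (block (c zero)) + count (toℕ j * w + t) (blocks _ (c ∘ suc))
      ≡⟨ cong₂ _+_ (weight zero) (count-blocks (c ∘ suc) (weight ∘ suc) j t≤w) ⟩
    m + (toℕ j * m + count t (block (c (suc j))))
      ≡⟨ +-assoc m (toℕ j * m) _ ⟨
    m + toℕ j * m + count t (block (c (suc j)))
      ∎
    where open ≡-Reasoning

  block-fits : ∀ {k n} (j : Fin k) {t} → k * w ≤ n → t ≤ w → toℕ j * w + t ≤ n
  block-fits {k} {n} j {t} kw≤n t≤w = begin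
    toℕ j * w + t ≤⟨ +-monoʳ-≤ (toℕ j * w) t≤w ⟩
    toℕ j * w + w ≡⟨ +-comm (toℕ j * w) w ⟩
    suc (toℕ j) * w ≤⟨ *-monoˡ-≤ w (toℕ<n j) ⟩
    k * w ≤⟨ kw≤n ⟩
    n ∎
    where open ≤-Reasoning

module GapBlock (δ : ℕ) where

  gap : ℕ → ℕ → Bool
  gap c q = does (q <? c) ∨ does (c + δ ≤? q)

  gap-below : ∀ {c q} → q < c → gap c q ≡ true
  gap-below {c} {q} q<c rewrite dec-true (q <? c) q<c = refl

  gap-within : ∀ {c q} → c ≤ q → q < c + δ → gap c q ≡ false
  gap-within {c} {q} c≤q q<c+δ
    rewrite dec-false (q <? c) (≤⇒≯ c≤q) | dec-false (c + δ ≤? q) (<⇒≱ q<c+δ) = refl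

  gap-above : ∀ {c q} → c + δ ≤ q → gap c q ≡ true
  gap-above {c} {q} c+δ≤q rewrite dec-true (c + δ ≤? q) c+δ≤q = ∨-zeroʳ _

  count-gap-below : ∀ {c t} → t ≤ c → count t (gap c) ≡ t
  count-gap-below t≤c = count-allTrue _ (λ q q<t → gap-below (<-≤-trans q<t t≤c))

  count-gap-within : ∀ {c t} → c ≤ t → t ≤ c + δ → count t (gap c) ≡ c
  count-gap-within {c} {t} c≤t t≤c+δ = begin
    count t (gap c)
      ≡⟨ cong (λ x → count x (gap c)) (m+[n∸m]≡n c≤t) ⟨
    count (c + (t ∸ c)) (gap c)
      ≡⟨ count-+ c (t ∸ c) (gap c) ⟩
    count c (gap c) + count (t ∸ c) (gap c ∘ (c +_))
      ≡⟨ cong₂ _+_ (count-gap-below ≤-refl) gap-middle ⟩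
    c + 0
      ≡⟨ +-identityʳ c ⟩
    c ∎
    where
    open ≡-Reasoning
    gap-middle : count (t ∸ c) (gap c ∘ (c +_)) ≡ 0
    gap-middle = count-allFalse _ (λ q q<t∸c → gap-within (m≤m+n c q)
      (+-monoʳ-< c (<-≤-trans q<t∸c (m≤n+o⇒m∸n≤o t c t≤c+δ))))

  count-gap-block : ∀ {c} → c ≤ δ → count (2 * δ) (gap c) ≡ δ
  count-gap-block {c} c≤δ = begin
    count (2 * δ) (gap c)
      ≡⟨ cong (λ x → count x (gap c)) split ⟩
    count (c + δ + (δ ∸ c)) (gap c)
      ≡⟨ count-+ (c + δ) (δ ∸ c) (gap c) ⟩
    count (c + δ) (gap c) + count (δ ∸ c) (gap c ∘ (c + δ +_))
      ≡⟨ cong₂ _+_ (count-gap-within (m≤m+n c δ) ≤-refl)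
                   (count-allTrue _ (λ q _ → gap-above (m≤m+n (c + δ) q))) ⟩
    c + (δ ∸ c)
      ≡⟨ m+[n∸m]≡n c≤δ ⟩
    δ ∎
    where
    open ≡-Reasoning
    split : 2 * δ ≡ c + δ + (δ ∸ c)
    split = begin
      2 * δ               ≡⟨ cong (δ +_) (+-identityʳ δ) ⟩
      δ + δ               ≡⟨ cong (δ +_) (m+[n∸m]≡n c≤δ) ⟨
      δ + (c + (δ ∸ c))   ≡⟨ +-assoc δ c (δ ∸ c) ⟨
      δ + c + (δ ∸ c)     ≡⟨ cong (_+ (δ ∸ c)) (+-comm δ c) ⟩
      c + δ + (δ ∸ c)     ∎

  m+δ≤2δ : ∀ {m} → m ≤ δ → m + δ ≤ 2 * δ
  m+δ≤2δ {m} m≤δ = subst (m + δ ≤_) (cong (δ +_) (sym (+-identityʳ δ))) (+-monoˡ-≤ δ m≤δ)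

funToFin-cong : ∀ {k m} {f g : Fin k → Fin m} → f ≗ g → funToFin f ≡ funToFin g
funToFin-cong {zero}  f≗g = refl
funToFin-cong {suc k} f≗g = cong₂ combine (f≗g zero) (funToFin-cong (f≗g ∘ suc))

injection⇒^≤ : ∀ {k m s} (E : (Fin k → Fin m) → Vec Bool s) →
  (∀ f g → E f ≡ E g → f ≗ g) → m ^ k ≤ 2 ^ s
injection⇒^≤ {k} {m} {s} E E-injective = injective⇒≤ {f = code} code-injective
  where
  open Inverse 2↔Bool using (to; from; strictlyInverseˡ)

  from-injective : ∀ {a b} → from a ≡ from b → a ≡ b
  from-injective {a} {b} eq =
    trans (sym (strictlyInverseˡ a)) (trans (cong to eq) (strictlyInverseˡ b))

  lookup-injective : ∀ {v w : Vec Bool s} → lookup v ≗ lookup w → v ≡ w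
  lookup-injective {v} {w} eq =
    trans (sym (tabulate∘lookup v)) (trans (tabulate-cong eq) (tabulate∘lookup w))

  decode : Fin (m ^ k) → (Fin k → Fin m)
  decode = finToFun

  code : Fin (m ^ k) → Fin (2 ^ s)
  code x = funToFin (from ∘ lookup (E (decode x)))

  code-injective : ∀ {x y} → code x ≡ code y → x ≡ y
  code-injective {x} {y} eq = begin
    x                    ≡⟨ funToFin-finToFin {k} x ⟨
    funToFin (decode x)  ≡⟨ funToFin-cong (E-injective _ _ (lookup-injective bits≗)) ⟩
    funToFin (decode y)  ≡⟨ funToFin-finToFin {k} y ⟩
    y                    ∎
    where
    open ≡-Reasoning
    bits≗ : lookup (E (decode x)) ≗ lookup (E (decode y))
    bits≗ i = from-injective (begin
      from (lookup (E (decode x)) i)  ≡⟨ finToFun-funToFin _ i ⟨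
      finToFun (code x) i             ≡⟨ cong (λ z → finToFun z i) eq ⟩
      finToFun (code y) i             ≡⟨ finToFun-funToFin _ i ⟩
      from (lookup (E (decode y)) i)  ∎)

-- Answer B i r: r is an acceptable reply to query i on B, the query's range conditions included,
-- so that Answers.Supports (RankAAnswer δ) is SupportsRankA δ by definition (likewise for dselectA).
RankAAnswer : ∀ {n} → ℕ → Vec Bool n → ℕ → ℕ → Set
RankAAnswer {n} δ B i r = 1 ≤ i → i ≤ n → IsRankA true i B δ r

DSelectAAnswer : ∀ {n} → ℕ → Vec Bool n → ℕ → ℕ → Set
DSelectAAnswer {n} δ B i p = 1 ≤ i → i ≤ rank true n B → IsDSelectA true i B δ p

isRankA-≤ : ∀ {n b i δ r} {B : Vec Bool n} → IsRankA b i B δ r → r ≤ rank b i B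
isRankA-≤ (inj₁ (_ , r≤rank)) = r≤rank
isRankA-≤ (inj₂ (_ , r≡rank)) = ≤-reflexive r≡rank

isRankA-> : ∀ {n b i δ r} {B : Vec Bool n} → rank b (i ∸ δ) B < rank b i B →
  IsRankA b i B δ r → rank b (i ∸ δ) B < r
isRankA-> _   (inj₁ (rank<r , _)) = rank<r
isRankA-> rank<rank (inj₂ (rank≡rank , _)) = ⊥-elim (<-irrefl rank≡rank rank<rank)

module Answers {n : ℕ} (Answer : Vec Bool n → ℕ → ℕ → Set) where

  Supports : ∀ {s} → DataStructure n s → Set
  Supports D = ∀ B i → Answer B i (DataStructure.query D (DataStructure.encode D B) i)

  Separated : Vec Bool n → Vec Bool n → Set
  Separated B B' = Σ ℕ λ i → ∀ r → Answer B i r → Answer B' i r → ⊥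

  encode-separated : ∀ {s} (D : DataStructure n s) → Supports D → ∀ {B B'} →
    Separated B B' → DataStructure.encode D B ≢ DataStructure.encode D B'
  encode-separated D supports {B} {B'} (i , separates) eq =
    separates (query (encode B) i) (supports B i)
      (subst (λ e → Answer B' i (query e i)) (sym eq) (supports B' i))
    where open DataStructure D

  separated⇒^≤ : ∀ {k δ s} (B : (Fin k → Fin δ) → Vec Bool n) →
    (∀ cs cs' j → toℕ (cs j) < toℕ (cs' j) → Separated (B cs) (B cs')) →
    (D : DataStructure n s) → Supports D → δ ^ k ≤ 2 ^ s
  separated⇒^≤ B separated D supports = injection⇒^≤ (encode ∘ B) encode-injective
    where
    open DataStructure D
    encode-injective : ∀ cs cs' → encode (B cs) ≡ encode (B cs') → cs ≗ cs'
    encode-injective cs cs' eq j with <-cmp (toℕ (cs j)) (toℕ (cs' j))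
    ... | tri< lt _ _ = ⊥-elim (encode-separated D supports (separated cs cs' j lt) eq)
    ... | tri≈ _ eq' _ = toℕ-injective eq'
    ... | tri> _ _ gt = ⊥-elim (encode-separated D supports (separated cs' cs j gt) (sym eq))

module HardInput (δ n : ℕ) {k : ℕ} (kD≤n : k * (2 * δ) ≤ n) where
  open GapBlock δ
  open Blocks (2 * δ) gap

  hardBits : (Fin k → Fin δ) → ℕ → Bool
  hardBits cs = blocks k (toℕ ∘ cs)

  hardInput : (Fin k → Fin δ) → Vec Bool n
  hardInput cs = tabulateℕ n (hardBits cs)

  count-hardBits : ∀ cs (j : Fin k) {t} → t ≤ 2 * δ →
    count (toℕ j * (2 * δ) + t) (hardBits cs) ≡ toℕ j * δ + count t (gap (toℕ (cs j)))
  count-hardBits cs = count-blocks (toℕ ∘ cs) (λ j → count-gap-block (<⇒≤ (toℕ<n (cs j))))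

  rank-hardInput : ∀ cs (j : Fin k) {t} → t ≤ 2 * δ →
    rank true (toℕ j * (2 * δ) + t) (hardInput cs) ≡ toℕ j * δ + count t (gap (toℕ (cs j)))
  rank-hardInput cs j t≤2δ =
    trans (rank-tabulateℕ (hardBits cs) (block-fits j kD≤n t≤2δ)) (count-hardBits cs j t≤2δ)

  select-hardInput : ∀ cs (j : Fin k) {q} → q < 2 * δ → gap (toℕ (cs j)) q ≡ true →
    select true (suc (toℕ j * δ + count q (gap (toℕ (cs j))))) (hardInput cs)
      ≡ suc (toℕ j * (2 * δ) + q)
  select-hardInput cs j q<2δ gap≡true =
    trans (cong (λ x → select true (suc x) (hardInput cs)) (sym (count-hardBits cs j (<⇒≤ q<2δ))))
          (select-tabulateℕ (hardBits cs)
            (subst (_≤ n) (+-suc (toℕ j * (2 * δ)) _) (block-fits j kD≤n q<2δ))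
            (trans (blocks-at (toℕ ∘ cs) j q<2δ) gap≡true))

  ones-through-block≤rank : ∀ cs (j : Fin k) → toℕ j * δ + δ ≤ rank true n (hardInput cs)
  ones-through-block≤rank cs j = begin
    toℕ j * δ + δ
      ≡⟨ cong (toℕ j * δ +_) (count-gap-block (<⇒≤ (toℕ<n (cs j)))) ⟨
    toℕ j * δ + count (2 * δ) (gap (toℕ (cs j)))
      ≡⟨ count-hardBits cs j ≤-refl ⟨
    count (toℕ j * (2 * δ) + 2 * δ) (hardBits cs)
      ≤⟨ count-mono (hardBits cs) (block-fits j kD≤n ≤-refl) ⟩
    count n (hardBits cs)
      ≡⟨ rank-tabulateℕ {n} (hardBits cs) ≤-refl ⟨
    rank true n (hardInput cs)
      ∎
    where open ≤-Reasoning

  rankA-separated : ∀ cs cs' j → toℕ (cs j) < toℕ (cs' j) →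
    Answers.Separated (RankAAnswer δ) (hardInput cs) (hardInput cs')
  rankA-separated cs cs' j d<d' = i , separates
    where
    d = toℕ (cs j)
    d' = toℕ (cs' j)
    base = toℕ j * (2 * δ)
    i = base + (d + δ)

    d+δ≤2δ : d + δ ≤ 2 * δ
    d+δ≤2δ = m+δ≤2δ (<⇒≤ (toℕ<n (cs j)))
    1≤i : 1 ≤ i
    1≤i = ≤-trans (s≤s z≤n) (≤-trans (toℕ<n (cs j)) (≤-trans (m≤n+m δ d) (m≤n+m (d + δ) base)))
    i≤n : i ≤ n
    i≤n = block-fits j kD≤n d+δ≤2δ
    i∸δ≡ : i ∸ δ ≡ base + d
    i∸δ≡ = trans (cong (_∸ δ) (sym (+-assoc base d δ))) (m+n∸n≡m (base + d) δ)

    rank-i : rank true i (hardInput cs) ≡ toℕ j * δ + d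
    rank-i = trans (rank-hardInput cs j d+δ≤2δ)
      (cong (toℕ j * δ +_) (count-gap-within (m≤m+n d δ) ≤-refl))
    rank'-i∸δ : rank true (i ∸ δ) (hardInput cs') ≡ toℕ j * δ + d
    rank'-i∸δ = trans (cong (λ x → rank true x (hardInput cs')) i∸δ≡)
      (trans (rank-hardInput cs' j (≤-trans (m≤m+n d δ) d+δ≤2δ))
        (cong (toℕ j * δ +_) (count-gap-below (<⇒≤ d<d'))))
    rank'-i : rank true i (hardInput cs') ≡ toℕ j * δ + d'
    rank'-i = trans (rank-hardInput cs' j d+δ≤2δ)
      (cong (toℕ j * δ +_) (count-gap-within (≤-trans (<⇒≤ (toℕ<n (cs' j))) (m≤n+m δ d))
                                             (+-monoˡ-≤ δ (<⇒≤ d<d'))))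

    separates : ∀ r → RankAAnswer δ (hardInput cs) i r → RankAAnswer δ (hardInput cs') i r → ⊥
    separates r answer answer' = <⇒≱ lower upper
      where
      upper : r ≤ toℕ j * δ + d
      upper = subst (r ≤_) rank-i (isRankA-≤ {i = i} {δ = δ} {B = hardInput cs} (answer 1≤i i≤n))
      lower : toℕ j * δ + d < r
      lower = subst (_< r) rank'-i∸δ (isRankA-> {i = i} {δ = δ} {B = hardInput cs'}
        (subst₂ _<_ (sym rank'-i∸δ) (sym rank'-i) (+-monoʳ-< (toℕ j * δ) d<d'))
        (answer' 1≤i i≤n))

  dselectA-separated : ∀ cs cs' j → toℕ (cs j) < toℕ (cs' j) →
    Answers.Separated (DSelectAAnswer δ) (hardInput cs) (hardInput cs')
  dselectA-separated cs cs' j d<d' = i , separates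
    where
    d = toℕ (cs j)
    base = toℕ j * (2 * δ)
    i = suc (toℕ j * δ + d)

    i≤rank : ∀ cs″ → i ≤ rank true n (hardInput cs″)
    i≤rank cs″ = ≤-trans (+-monoʳ-< (toℕ j * δ) (toℕ<n (cs j))) (ones-through-block≤rank cs″ j)

    select-i : select true i (hardInput cs) ≡ suc (base + (d + δ))
    select-i = trans
      (cong (λ x → select true (suc (toℕ j * δ + x)) (hardInput cs))
            (sym (count-gap-within (m≤m+n d δ) ≤-refl)))
      (select-hardInput cs j (m+δ≤2δ (toℕ<n (cs j))) (gap-above {d} ≤-refl))
    select'-i : select true i (hardInput cs') ≡ suc (base + d)
    select'-i = trans
      (cong (λ x → select true (suc (toℕ j * δ + x)) (hardInput cs'))
            (sym (count-gap-below (<⇒≤ d<d'))))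
      (select-hardInput cs' j (<-≤-trans (toℕ<n (cs j)) (m≤m+n δ _)) (gap-below d<d'))

    separates : ∀ p → DSelectAAnswer δ (hardInput cs) i p →
      DSelectAAnswer δ (hardInput cs') i p → ⊥
    separates p answer answer' = <-irrefl refl (<-≤-trans lower upper)
      where
      lower : suc (base + (d + δ)) < p + δ
      lower = subst (_< p + δ) select-i (proj₁ (answer (s≤s z≤n) (i≤rank cs)))
      upper : p + δ ≤ suc (base + (d + δ))
      upper = subst (p + δ ≤_) (cong suc (+-assoc base d δ))
        (+-monoˡ-≤ δ (subst (p ≤_) select'-i (proj₂ (answer' (s≤s z≤n) (i≤rank cs')))))

theorem3 : (n δ : ℕ) → 1 ≤ n → 1 ≤ δ → .{{_ : NonZero (2 * δ)}} →
    ((s : ℕ) (D : DataStructure n s) → SupportsRankA δ D →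
      δ ^ (n / (2 * δ)) ≤ 2 ^ s)
    × ((s : ℕ) (D : DataStructure n s) → SupportsDSelectA δ D →
      δ ^ (n / (2 * δ)) ≤ 2 ^ s)
theorem3 n δ _ _ =
    (λ _ → Answers.separated⇒^≤ (RankAAnswer δ) hardInput rankA-separated)
  , (λ _ → Answers.separated⇒^≤ (DSelectAAnswer δ) hardInput dselectA-separated)
  where open HardInput δ n {n / (2 * δ)} (m/n*n≤m n (2 * δ))
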